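{- Let $K$ be a field of characteristic not $2$, and let $E$ be a nonsingular elliptic curve over $K$ defined by $y^2=f(x)=x^3+Ax+B$ with $A,B\in K$. Let $\alpha=(u,v)$ and $\beta=(x_0,0)$ be points on $E$. Then $$2\alpha=\beta \iff (u-x_0)^2=f'(x_0),$$ where $f'(x)=3x^2+A$.
   Context: Here $2\alpha$ denotes doubling with respect to the usual group law on $E$ (with the point at infinity as identity). -}

module Defs where

open import Level using (Level; _⊔_; Lift) renaming (suc to lsuc)
open import Algebra.Bundles using (CommutativeRing)
open import Data.Nat using (ℕ; zero; suc)
open import Data.Product using (Σ; ∃; _×_; _,_)
open import Data.Unit using (⊤)
open import Data.Empty using (⊥)
open import Relation.Nullary using (¬_)

record Field (c ℓ : Level) : Set (lsuc (c ⊔ ℓ)) where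
  field
    commutativeRing : CommutativeRing c ℓ
  open CommutativeRing commutativeRing public
  field
    1≉0     : ¬ (1# ≈ 0#)
    inverse : ∀ x → ¬ (x ≈ 0#) → ∃ λ y → (x * y) ≈ 1#

module FieldOps {c ℓ : Level} (K : Field c ℓ) where
  open Field K

  ι : ℕ → Carrier
  ι zero    = 0#
  ι (suc n) = 1# + ι n

  _² : Carrier → Carrier
  x ² = x * x

  _³ : Carrier → Carrier
  x ³ = x * x * x

  CharNot2 : Set ℓ
  CharNot2 = ¬ (ι 2 ≈ 0#)

module Curve {c ℓ : Level} (K : Field c ℓ) (A B : Field.Carrier K) where
  open Field K
  open FieldOps K

  f : Carrier → Carrier
  f x = x ³ + A * x + B

  f′ : Carrier → Carrier
  f′ x = ι 3 * x ² + A

  Nonsingular : Set ℓ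
  Nonsingular = ¬ ((ι 4 * A ³ + ι 27 * B ²) ≈ 0#)

  data Point : Set c where
    O   : Point
    aff : Carrier → Carrier → Point

  OnE : Point → Set ℓ
  OnE O         = Lift ℓ ⊤
  OnE (aff x y) = y ² ≈ f x

  -- Double P Q  means  2P = Q  for the usual group law (identity O).
  -- Doubling: 2O = O; 2(u,v) = O if v = 0; otherwise
  -- 2(u,v) = (λ² - 2u , λ(u - x') - v) with λ = (3u² + A)/(2v).
  Double : Point → Point → Set (c ⊔ ℓ)
  Double O         O         = Lift (c ⊔ ℓ) ⊤
  Double O         (aff _ _) = Lift (c ⊔ ℓ) ⊥
  Double (aff u v) O         = Lift (c ⊔ ℓ) (v ≈ 0#)
  Double (aff u v) (aff x y) =
    ¬ (v ≈ 0#) ×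
    Σ Carrier (λ lam → ((lam * (ι 2 * v)) ≈ (ι 3 * u ² + A))
                      × (x ≈ (lam ² - ι 2 * u))
                      × (y ≈ (lam * (u - x) - v)))

-- Write t = u - x₀.  Since x₀ is a root of f, f u = f u - f x₀ = t (t² + 3x₀t + f′ x₀).
-- If the doubling slope λ exists, then v = λt and λ² = 2u + x₀, and these two
-- relations turn the tangent condition λ·2v = 3u² + A into exactly t² = f′ x₀.
-- Conversely, if t² = f′ x₀ then v² = t²(2t + 3x₀), while A and B become polynomials
-- in t and x₀ for which 4A³ + 27B² = t²(2t - 3x₀) · t²(2t + 3x₀); nonsingularity
-- therefore forces v ≠ 0, hence t ≠ 0, and λ = v/t is the slope of the doubling.
{-# OPTIONS --safe #-}
module Submission where

open import Defs
open import Level using (Level)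
open import Algebra.Bundles using (Ring; CommutativeRing)
open import Algebra.Solver.Ring.AlmostCommutativeRing
  using (fromCommutativeRing; _-Raw-AlmostCommutative⟶_)
open import Data.Nat as ℕ using (suc)
open import Data.Nat.Properties using (+-suc)
open import Data.Integer as ℤ using (ℤ; +_; -[1+_])
open import Data.Integer.Properties using ([1+m]⊖[1+n]≡m⊖n; +◃n≡+n; -◃n≡-n)
import Data.Sign as Sign
open import Data.Maybe using (Maybe; just; nothing)
open import Data.Product using (_,_; proj₁; proj₂)
open import Function.Bundles using (_⇔_; mk⇔)
import Relation.Binary.PropositionalEquality as ≡
open import Relation.Nullary using (¬_; yes; no)

module IntegerCoefficientSolver {c ℓ : Level} (R : CommutativeRing c ℓ) where
  open CommutativeRing R
  open import Algebra.Properties.Ring ring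
  open import Algebra.Properties.Semiring.Mult semiring
  open import Relation.Binary.Reasoning.Setoid setoid

  -- n × 1# is definitionally FieldOps.ι n, so the solver's constants are the
  -- numerals ι 2, ι 3, … occurring in the curve equations.
  ⟦_⟧ℤ : ℤ → Carrier
  ⟦ + n ⟧ℤ      = n × 1#
  ⟦ -[1+ n ] ⟧ℤ = - (suc n × 1#)

  1+x-[1+y]≈x-y : ∀ x y → (1# + x) - (1# + y) ≈ x - y
  1+x-[1+y]≈x-y x y = begin
    (1# + x) - (1# + y)       ≈⟨ +-congˡ (-‿anti-homo-+ 1# y) ⟩
    (1# + x) + (- y - 1#)     ≈⟨ +-assoc _ _ _ ⟨
    (1# + x) + - y - 1#       ≈⟨ +-congʳ (+-assoc 1# x (- y)) ⟩
    1# + (x - y) - 1#         ≈⟨ xyx⁻¹≈y 1# (x - y) ⟩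
    x - y                     ∎

  ⊖-homo : ∀ m n → ⟦ m ℤ.⊖ n ⟧ℤ ≈ m × 1# - n × 1#
  ⊖-homo ℕ.zero    ℕ.zero    = sym (-‿inverseʳ 0#)
  ⊖-homo ℕ.zero    (suc n)   = sym (+-identityˡ _)
  ⊖-homo (suc m)   ℕ.zero    = sym (trans (+-congˡ -0#≈0#) (+-identityʳ _))
  ⊖-homo (suc m)   (suc n)   = begin
    ⟦ suc m ℤ.⊖ suc n ⟧ℤ         ≡⟨ ≡.cong ⟦_⟧ℤ ([1+m]⊖[1+n]≡m⊖n m n) ⟩
    ⟦ m ℤ.⊖ n ⟧ℤ                 ≈⟨ ⊖-homo m n ⟩
    m × 1# - n × 1#              ≈⟨ 1+x-[1+y]≈x-y _ _ ⟨
    suc m × 1# - suc n × 1#      ∎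

  +-homo : ∀ i j → ⟦ i ℤ.+ j ⟧ℤ ≈ ⟦ i ⟧ℤ + ⟦ j ⟧ℤ
  +-homo (+ m)    (+ n)    = ×-homo-+ 1# m n
  +-homo (+ m)    -[1+ n ] = ⊖-homo m (suc n)
  +-homo -[1+ m ] (+ n)    = trans (⊖-homo n (suc m)) (+-comm _ _)
  +-homo -[1+ m ] -[1+ n ] = begin
    - (suc (suc (m ℕ.+ n)) × 1#)          ≡⟨ ≡.cong (λ k → - (suc k × 1#)) (+-suc m n) ⟨
    - ((suc m ℕ.+ suc n) × 1#)            ≈⟨ -‿cong (×-homo-+ 1# (suc m) (suc n)) ⟩
    - (suc m × 1# + suc n × 1#)           ≈⟨ -‿+-comm _ _ ⟨
    - (suc m × 1#) + - (suc n × 1#)       ∎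

  -‿homo : ∀ i → ⟦ ℤ.- i ⟧ℤ ≈ - ⟦ i ⟧ℤ
  -‿homo (+ ℕ.zero) = sym -0#≈0#
  -‿homo (+ suc n)  = refl
  -‿homo -[1+ n ]   = sym (-‿involutive _)

  +◃-homo : ∀ n → ⟦ Sign.+ ℤ.◃ n ⟧ℤ ≈ n × 1#
  +◃-homo n = reflexive (≡.cong ⟦_⟧ℤ (+◃n≡+n n))

  -◃-homo : ∀ n → ⟦ Sign.- ℤ.◃ n ⟧ℤ ≈ - (n × 1#)
  -◃-homo n = trans (reflexive (≡.cong ⟦_⟧ℤ (-◃n≡-n n))) (-‿homo (+ n))

  *-homo : ∀ i j → ⟦ i ℤ.* j ⟧ℤ ≈ ⟦ i ⟧ℤ * ⟦ j ⟧ℤ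
  *-homo (+ m)    (+ n)    = trans (+◃-homo (m ℕ.* n)) (×1-homo-* m n)
  *-homo (+ m)    -[1+ n ] = begin
    ⟦ Sign.- ℤ.◃ (m ℕ.* suc n) ⟧ℤ   ≈⟨ -◃-homo (m ℕ.* suc n) ⟩
    - ((m ℕ.* suc n) × 1#)          ≈⟨ -‿cong (×1-homo-* m (suc n)) ⟩
    - (m × 1# * suc n × 1#)         ≈⟨ -‿distribʳ-* _ _ ⟩
    m × 1# * - (suc n × 1#)         ∎
  *-homo -[1+ m ] (+ n)    = begin
    ⟦ Sign.- ℤ.◃ (suc m ℕ.* n) ⟧ℤ   ≈⟨ -◃-homo (suc m ℕ.* n) ⟩
    - ((suc m ℕ.* n) × 1#)          ≈⟨ -‿cong (×1-homo-* (suc m) n) ⟩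
    - (suc m × 1# * n × 1#)         ≈⟨ -‿distribˡ-* _ _ ⟩
    - (suc m × 1#) * n × 1#         ∎
  *-homo -[1+ m ] -[1+ n ] = begin
    ⟦ Sign.+ ℤ.◃ (suc m ℕ.* suc n) ⟧ℤ ≈⟨ +◃-homo (suc m ℕ.* suc n) ⟩
    (suc m ℕ.* suc n) × 1#          ≈⟨ ×1-homo-* (suc m) (suc n) ⟩
    a * b                           ≈⟨ -‿involutive _ ⟨
    - - (a * b)                     ≈⟨ -‿cong (-‿distribˡ-* a b) ⟩
    - (- a * b)                     ≈⟨ -‿distribʳ-* (- a) b ⟩
    - a * - b                       ∎
    where a b : Carrier
          a = suc m × 1#
          b = suc n × 1#

  ℤ-morphism : ℤ.+-*-rawRing -Raw-AlmostCommutative⟶ fromCommutativeRing R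
  ℤ-morphism = record
    { ⟦_⟧ = ⟦_⟧ℤ ; +-homo = +-homo ; *-homo = *-homo ; -‿homo = -‿homo
    ; 0-homo = refl ; 1-homo = +-identityʳ 1# }

  ≡⇒≈? : ∀ i j → Maybe (⟦ i ⟧ℤ ≈ ⟦ j ⟧ℤ)
  ≡⇒≈? i j with i ℤ.≟ j
  ... | yes ≡.refl = just refl
  ... | no _       = nothing

  open import Algebra.Solver.Ring ℤ.+-*-rawRing (fromCommutativeRing R) ℤ-morphism ≡⇒≈? public

-- a ≈ b follows from hypotheses lᵢ ≈ rᵢ as soon as a - b ≈ Σ cᵢ (lᵢ - rᵢ) is a
-- ring identity, which the solver then certifies.
module LinearCombination {c ℓ : Level} (R : Ring c ℓ) where
  open Ring R
  open import Algebra.Properties.Ring R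

  infixl 6 _⊕_

  scaled : ∀ {k l r} → l ≈ r → k * (l - r) ≈ 0#
  scaled {k} l≈r = trans (*-congˡ (x≈y⇒x∙y⁻¹≈ε l≈r)) (zeroʳ k)

  _⊕_ : ∀ {x y} → x ≈ 0# → y ≈ 0# → x + y ≈ 0#
  x≈0 ⊕ y≈0 = trans (+-cong x≈0 y≈0) (+-identityʳ 0#)

  linear-combination : ∀ {a b e} → a - b ≈ e → e ≈ 0# → a ≈ b
  linear-combination a-b≈e e≈0 = x∙y⁻¹≈ε⇒x≈y _ _ (trans a-b≈e e≈0)

module FieldProperties {c ℓ : Level} (K : Field c ℓ) where
  open Field K
  open import Relation.Binary.Reasoning.Setoid setoid

  x≉0⇒x*y≈0⇒y≈0 : ∀ {x y} → ¬ x ≈ 0# → x * y ≈ 0# → y ≈ 0#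
  x≉0⇒x*y≈0⇒y≈0 {x} {y} x≉0 xy≈0 = begin
    y               ≈⟨ *-identityˡ y ⟨
    1# * y          ≈⟨ *-congʳ x⁻¹x≈1 ⟨
    x⁻¹ * x * y     ≈⟨ *-assoc x⁻¹ x y ⟩
    x⁻¹ * (x * y)   ≈⟨ *-congˡ xy≈0 ⟩
    x⁻¹ * 0#        ≈⟨ zeroʳ x⁻¹ ⟩
    0#              ∎
    where x⁻¹ : Carrier
          x⁻¹ = proj₁ (inverse x x≉0)
          x⁻¹x≈1 : x⁻¹ * x ≈ 1#
          x⁻¹x≈1 = trans (*-comm x⁻¹ x) (proj₂ (inverse x x≉0))

module Doubling {c ℓ : Level} (K : Field c ℓ) (A B : Field.Carrier K) where
  open Field K
  open FieldOps K
  open Curve K A B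
  open IntegerCoefficientSolver commutativeRing
  open LinearCombination ring
  open FieldProperties K
  open import Algebra.Properties.Ring ring using (x≈y⇒x∙y⁻¹≈ε; x∙y⁻¹≈ε⇒x≈y)
  open import Algebra.Properties.Semiring.Mult semiring using (×-homo-1)
  open import Relation.Binary.Reasoning.Setoid setoid

  tangency-defect : ∀ {u v x₀ m} → x₀ ≈ m ² - ι 2 * u → 0# ≈ m * (u - x₀) - v →
                    m * (ι 2 * v) - (ι 3 * u ² + A) ≈ (u - x₀) ² - f′ x₀
  tangency-defect {u} {v} {x₀} {m} x₀≈m²-2u 0≈m[u-x₀]-v = linear-combination
    (solve 5 (λ u v x A m →
        (m :* (con (+ 2) :* v) :- (con (+ 3) :* (u :* u) :+ A))
          :- ((u :- x) :* (u :- x) :- (con (+ 3) :* (x :* x) :+ A))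
      := (:- (con (+ 2) :* (u :- x))) :* (x :- (m :* m :- con (+ 2) :* u))
         :+ (con (+ 2) :* m) :* (con (+ 0) :- (m :* (u :- x) :- v)))
      refl u v x₀ A m)
    (scaled x₀≈m²-2u ⊕ scaled 0≈m[u-x₀]-v)

  double⇒tangency : ∀ {u v x₀} → Double (aff u v) (aff x₀ 0#) → (u - x₀) ² ≈ f′ x₀
  double⇒tangency (_ , m , tangent , x₀≈m²-2u , 0≈m[u-x₀]-v) = x∙y⁻¹≈ε⇒x≈y _ _
    (trans (sym (tangency-defect x₀≈m²-2u 0≈m[u-x₀]-v)) (x≈y⇒x∙y⁻¹≈ε tangent))

  ordinate²-at-double-root : ∀ {u v x₀} → v ² ≈ f u → 0# ² ≈ f x₀ → (u - x₀) ² ≈ f′ x₀ →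
                             v ² ≈ (u - x₀) ² * (ι 2 * (u - x₀) + ι 3 * x₀)
  ordinate²-at-double-root {u} {v} {x₀} v²≈fu 0≈fx₀ tangency = linear-combination
    (solve 5 (λ u x A B v → let t = u :- x in
        v :* v :- t :* t :* (con (+ 2) :* t :+ con (+ 3) :* x)
      := con (+ 1) :* (v :* v :- (u :* u :* u :+ A :* u :+ B))
         :+ (:- con (+ 1)) :* (con (+ 0) :* con (+ 0) :- (x :* x :* x :+ A :* x :+ B))
         :+ (:- t) :* (t :* t :- (con (+ 3) :* (x :* x) :+ A)))
      refl u x₀ A B v)
    (scaled v²≈fu ⊕ scaled 0≈fx₀ ⊕ scaled tangency)

  A-at-double-root : ∀ {u x₀} → (u - x₀) ² ≈ f′ x₀ → A ≈ (u - x₀) ² - ι 3 * x₀ ²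
  A-at-double-root {u} {x₀} tangency = linear-combination
    (solve 3 (λ u x A → let t = u :- x in
        A :- (t :* t :- con (+ 3) :* (x :* x))
      := (:- con (+ 1)) :* (t :* t :- (con (+ 3) :* (x :* x) :+ A)))
      refl u x₀ A)
    (scaled tangency)

  B-at-double-root : ∀ {u x₀} → 0# ² ≈ f x₀ → (u - x₀) ² ≈ f′ x₀ →
                     B ≈ ι 2 * x₀ ³ - (u - x₀) ² * x₀
  B-at-double-root {u} {x₀} 0≈fx₀ tangency = linear-combination
    (solve 4 (λ u x A B → let t = u :- x in
        B :- (con (+ 2) :* (x :* x :* x) :- t :* t :* x)
      := x :* (t :* t :- (con (+ 3) :* (x :* x) :+ A))
         :+ (:- con (+ 1)) :* (con (+ 0) :* con (+ 0) :- (x :* x :* x :+ A :* x :+ B)))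
      refl u x₀ A B)
    (scaled tangency ⊕ scaled 0≈fx₀)

  discriminant-factorisation : ∀ t x →
    ι 4 * (t ² - ι 3 * x ²) ³ + ι 27 * (ι 2 * x ³ - t ² * x) ²
      ≈ t ² * (ι 2 * t - ι 3 * x) * (t ² * (ι 2 * t + ι 3 * x))
  discriminant-factorisation = solve 2 (λ t x →
    let a = t :* t :- con (+ 3) :* (x :* x)
        b = con (+ 2) :* (x :* x :* x) :- t :* t :* x
    in  con (+ 4) :* (a :* a :* a) :+ con (+ 27) :* (b :* b)
      := t :* t :* (con (+ 2) :* t :- con (+ 3) :* x)
         :* (t :* t :* (con (+ 2) :* t :+ con (+ 3) :* x)))
    refl

  tangency⇒double : ∀ {u v x₀} → Nonsingular → OnE (aff u v) → OnE (aff x₀ 0#) →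
                    (u - x₀) ² ≈ f′ x₀ → Double (aff u v) (aff x₀ 0#)
  tangency⇒double {u} {v} {x₀} nonsingular v²≈fu 0≈fx₀ tangency =
    v≉0 , m , tangent , x₀≈m²-2u , 0≈m[u-x₀]-v
    where
    t : Carrier
    t = u - x₀

    v²≈t²[2t+3x₀] : v ² ≈ t ² * (ι 2 * t + ι 3 * x₀)
    v²≈t²[2t+3x₀] = ordinate²-at-double-root v²≈fu 0≈fx₀ tangency

    v≉0 : ¬ v ≈ 0#
    v≉0 v≈0 = nonsingular (begin
      ι 4 * A ³ + ι 27 * B ²
        ≈⟨ +-cong (*-congˡ (*-cong (*-cong A≈ A≈) A≈)) (*-congˡ (*-cong B≈ B≈)) ⟩
      ι 4 * (t ² - ι 3 * x₀ ²) ³ + ι 27 * (ι 2 * x₀ ³ - t ² * x₀) ²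
        ≈⟨ discriminant-factorisation t x₀ ⟩
      Q * (t ² * (ι 2 * t + ι 3 * x₀))  ≈⟨ *-congˡ v²≈t²[2t+3x₀] ⟨
      Q * v ²                           ≈⟨ *-congˡ (trans (*-congˡ v≈0) (zeroʳ v)) ⟩
      Q * 0#                            ≈⟨ zeroʳ Q ⟩
      0#                                ∎)
      where A≈ : A ≈ t ² - ι 3 * x₀ ²
            A≈ = A-at-double-root tangency
            B≈ : B ≈ ι 2 * x₀ ³ - t ² * x₀
            B≈ = B-at-double-root 0≈fx₀ tangency
            Q : Carrier
            Q = t ² * (ι 2 * t - ι 3 * x₀)

    t≉0 : ¬ t ≈ 0#
    t≉0 t≈0 = v≉0 (x≉0⇒x*y≈0⇒y≈0 v≉0 (begin
      v ²                               ≈⟨ v²≈t²[2t+3x₀] ⟩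
      t * t * (ι 2 * t + ι 3 * x₀)      ≈⟨ *-congʳ (trans (*-congʳ t≈0) (zeroˡ t)) ⟩
      0# * (ι 2 * t + ι 3 * x₀)         ≈⟨ zeroˡ _ ⟩
      0#                                ∎))

    s : Carrier
    s = proj₁ (inverse t t≉0)

    ts≈1 : t * s ≈ ι 1
    ts≈1 = trans (proj₂ (inverse t t≉0)) (sym (×-homo-1 1#))

    m : Carrier
    m = v * s

    x₀≈m²-2u : x₀ ≈ m ² - ι 2 * u
    x₀≈m²-2u = linear-combination
      (solve 4 (λ u x v s → let t = u :- x in
          x :- (v :* s :* (v :* s) :- con (+ 2) :* u)
        := (:- (s :* s)) :* (v :* v :- t :* t :* (con (+ 2) :* t :+ con (+ 3) :* x))
           :+ (:- ((t :* s :+ con (+ 1)) :* (con (+ 2) :* t :+ con (+ 3) :* x)))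
              :* (t :* s :- con (+ 1)))
        refl u x₀ v s)
      (scaled v²≈t²[2t+3x₀] ⊕ scaled ts≈1)

    0≈m[u-x₀]-v : 0# ≈ m * (u - x₀) - v
    0≈m[u-x₀]-v = linear-combination
      (solve 4 (λ u x v s →
          con (+ 0) :- (v :* s :* (u :- x) :- v) := (:- v) :* ((u :- x) :* s :- con (+ 1)))
        refl u x₀ v s)
      (scaled ts≈1)

    tangent : m * (ι 2 * v) ≈ ι 3 * u ² + A
    tangent = x∙y⁻¹≈ε⇒x≈y _ _
      (trans (tangency-defect x₀≈m²-2u 0≈m[u-x₀]-v) (x≈y⇒x∙y⁻¹≈ε tangency))

lemma5p1 : ∀ {c ℓ : Level} (K : Field c ℓ) → FieldOps.CharNot2 K →
    (A B : Field.Carrier K) → Curve.Nonsingular K A B →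
    (u v x₀ : Field.Carrier K) →
    Curve.OnE K A B (Curve.aff u v) → Curve.OnE K A B (Curve.aff x₀ (Field.0# K)) →
    Curve.Double K A B (Curve.aff u v) (Curve.aff x₀ (Field.0# K))
      ⇔ (Field._≈_ K (FieldOps._² K (Field._-_ K u x₀)) (Curve.f′ K A B x₀))
lemma5p1 K _ A B nonsingular u v x₀ onE-α onE-β =
  mk⇔ double⇒tangency (tangency⇒double nonsingular onE-α onE-β)
  where open Doubling K A B
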